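{- Let $W$ be a nonempty set, $R$ a reflexive and symmetric binary relation on $W$, and $\mathcal D$ a family of subsets of $W$ containing $\varnothing$ and $W$ and closed under finite unions and intersections. Define on $\mathcal D$: $aC_Rb$ iff there exist $x\in a$, $y\in b$ with $xRy$; $a\widehat C_Rb$ iff there exist $x\notin a$, $y\notin b$ with $xRy$; $a\ll_R b$ iff there do not exist $x\in a$, $y\notin b$ with $xRy$. Then $(\mathcal D,\subseteq,\varnothing,W,\cup,\cap,C_R,\widehat C_R,\ll_R)$ is an EDC-lattice.
   Context: An EDC-lattice is a structure $(D,\le,0,1,+,\cdot,C,\widehat C,\ll)$ where $(D,\le,0,1,+,\cdot)$ is a bounded distributive lattice and $C,\widehat C,\ll$ are binary relations on $D$ such that for all $a,a',b,b',c,d\in D$ (writing $\overline R$ for the complement of a relation $R$): (C1) $aCb\Rightarrow a\neq0,b\ne 0$; (C2) $aCb$, $a\le a'$, $b\le b'\Rightarrow a'Cb'$; (C3) $aC(b+c)\Rightarrow aCb$ or $aCc$; (C4) $aCb\Rightarrow bCa$; (C5) $a\cdot b\ne0\Rightarrow aCb$; ($\widehat C$1) $a\widehat Cb\Rightarrow a\ne1,b\ne1$; ($\widehat C$2) $a\widehat Cb$, $a'\le a$, $b'\le b\Rightarrow a'\widehat Cb'$; ($\widehat C$3) $a\widehat C(b\cdot c)\Rightarrow a\widehat Cb$ or $a\widehat Cc$; ($\widehat C$4) $a\widehat Cb\Rightarrow b\widehat Ca$; ($\widehat C$5) $a+b\ne1\Rightarrow a\widehat Cb$; ($\ll$1) $0\ll0$;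 ($\ll$2) $1\ll1$; ($\ll$3) $a\ll b\Rightarrow a\le b$; ($\ll$4) $a'\le a\ll b\le b'\Rightarrow a'\ll b'$; ($\ll$5) $a\ll c$, $b\ll c\Rightarrow a+b\ll c$; ($\ll$6) $c\ll a$, $c\ll b\Rightarrow c\ll a\cdot b$; ($\ll$7) $a\ll b$, $b\cdot c\ll d$, $c\ll a+d\Rightarrow c\ll d$; (MC1) $aCb$, $a\ll c\Rightarrow aC(b\cdot c)$; (MC2) $a\overline C(b\cdot c)$, $aCb$, $(a\cdot d)\overline Cb\Rightarrow d\widehat Cc$; (M$\widehat C$1) $a\widehat Cb$, $c\ll a\Rightarrow a\widehat C(b+c)$; (M$\widehat C$2) $a\overline{\widehat C}(b+c)$, $a\widehat Cb$, $(a+d)\overline{\widehat C}b\Rightarrow dCc$; (M$\ll$1) $a\overline{\widehat C}b$, $a\cdot c\ll b\Rightarrow c\ll b$; (M$\ll$2) $a\overline Cb$, $b\ll a+c\Rightarrow b\ll c$. -}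

module Defs where

open import Level using (Level; _⊔_; 0ℓ) renaming (suc to lsuc)
open import Data.Product using (Σ; ∃; ∃-syntax; _×_; _,_; proj₁)
open import Relation.Nullary using (¬_)
open import Data.Sum using (_⊎_)
open import Relation.Binary.Core using (Rel)
open import Relation.Binary.Lattice.Structures using (IsBoundedLattice)
open import Algebra.Core using (Op₂)
open import Algebra.Definitions using (_DistributesOverˡ_)
open import Relation.Unary using (Pred; _∈_; _∉_; _⊆_; ∅; U; _∪_; _∩_)

record IsEDCLattice {a ℓ₁ ℓ₂ ℓ₃ ℓ₄ ℓ₅ : Level} {D : Set a}
  (_≈_ : Rel D ℓ₁) (_≤_ : Rel D ℓ₂)
  (𝟘 𝟙 : D) (_+_ _·_ : Op₂ D)
  (C : Rel D ℓ₃) (Ĉ : Rel D ℓ₄) (_≪_ : Rel D ℓ₅)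
  : Set (a ⊔ ℓ₁ ⊔ ℓ₂ ⊔ ℓ₃ ⊔ ℓ₄ ⊔ ℓ₅) where
  field
    isBoundedLattice : IsBoundedLattice _≈_ _≤_ _+_ _·_ 𝟙 𝟘
    ·-distribˡ-+     : _DistributesOverˡ_ _≈_ _·_ _+_
    C1 : ∀ {a b} → C a b → ¬ (a ≈ 𝟘) × ¬ (b ≈ 𝟘)
    C2 : ∀ {a a′ b b′} → C a b → a ≤ a′ → b ≤ b′ → C a′ b′
    C3 : ∀ {a b c} → C a (b + c) → C a b ⊎ C a c
    C4 : ∀ {a b} → C a b → C b a
    C5 : ∀ {a b} → ¬ ((a · b) ≈ 𝟘) → C a b
    Ĉ1 : ∀ {a b} → Ĉ a b → ¬ (a ≈ 𝟙) × ¬ (b ≈ 𝟙)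
    Ĉ2 : ∀ {a a′ b b′} → Ĉ a b → a′ ≤ a → b′ ≤ b → Ĉ a′ b′
    Ĉ3 : ∀ {a b c} → Ĉ a (b · c) → Ĉ a b ⊎ Ĉ a c
    Ĉ4 : ∀ {a b} → Ĉ a b → Ĉ b a
    Ĉ5 : ∀ {a b} → ¬ ((a + b) ≈ 𝟙) → Ĉ a b
    ≪1 : 𝟘 ≪ 𝟘
    ≪2 : 𝟙 ≪ 𝟙
    ≪3 : ∀ {a b} → a ≪ b → a ≤ b
    ≪4 : ∀ {a a′ b b′} → a′ ≤ a → a ≪ b → b ≤ b′ → a′ ≪ b′
    ≪5 : ∀ {a b c} → a ≪ c → b ≪ c → (a + b) ≪ c
    ≪6 : ∀ {a b c} → c ≪ a → c ≪ b → c ≪ (a · b)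
    ≪7 : ∀ {a b c d} → a ≪ b → (b · c) ≪ d → c ≪ (a + d) → c ≪ d
    MC1  : ∀ {a b c} → C a b → a ≪ c → C a (b · c)
    MC2  : ∀ {a b c d} → ¬ C a (b · c) → C a b → ¬ C (a · d) b → Ĉ d c
    MĈ1  : ∀ {a b c} → Ĉ a b → c ≪ a → Ĉ a (b + c)
    MĈ2  : ∀ {a b c d} → ¬ Ĉ a (b + c) → Ĉ a b → ¬ Ĉ (a + d) b → C d c
    M≪1  : ∀ {a b c} → ¬ Ĉ a b → (a · c) ≪ b → c ≪ b
    M≪2  : ∀ {a b c} → ¬ C a b → b ≪ (a + c) → b ≪ c

-- The relational model on a family of subsets of W.
-- Subsets of W are predicates W → Set; the family 𝒟 is a predicate on
-- subsets; elements of 𝒟 are pairs (subset , membership proof).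

module RelModel {W : Set} (R : Rel W 0ℓ) (𝒟 : Pred (Pred W 0ℓ) 0ℓ) where

  Carrier : Set₁
  Carrier = Σ (Pred W 0ℓ) (λ a → a ∈ 𝒟)

  _≈ᴰ_ : Rel Carrier 0ℓ
  a ≈ᴰ b = (proj₁ a ⊆ proj₁ b) × (proj₁ b ⊆ proj₁ a)

  _⊆ᴰ_ : Rel Carrier 0ℓ
  a ⊆ᴰ b = proj₁ a ⊆ proj₁ b

  C-R : Rel Carrier 0ℓ
  C-R a b = ∃[ x ] ∃[ y ] (x ∈ proj₁ a × y ∈ proj₁ b × R x y)

  Ĉ-R : Rel Carrier 0ℓ
  Ĉ-R a b = ∃[ x ] ∃[ y ] (x ∉ proj₁ a × y ∉ proj₁ b × R x y)

  ≪-R : Rel Carrier 0ℓ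
  ≪-R a b = ¬ (∃[ x ] ∃[ y ] (x ∈ proj₁ a × y ∉ proj₁ b × R x y))

  module Ops (∅∈𝒟 : ∅ ∈ 𝒟) (U∈𝒟 : U ∈ 𝒟)
             (∪-closed : ∀ {a b} → a ∈ 𝒟 → b ∈ 𝒟 → (a ∪ b) ∈ 𝒟)
             (∩-closed : ∀ {a b} → a ∈ 𝒟 → b ∈ 𝒟 → (a ∩ b) ∈ 𝒟) where

    𝟘ᴰ : Carrier
    𝟘ᴰ = ∅ , ∅∈𝒟

    𝟙ᴰ : Carrier
    𝟙ᴰ = U , U∈𝒟

    _∪ᴰ_ : Op₂ Carrier
    (a , p) ∪ᴰ (b , q) = (a ∪ b) , ∪-closed p q

    _∩ᴰ_ : Op₂ Carrier
    (a , p) ∩ᴰ (b , q) = (a ∩ b) , ∩-closed p q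

-- Every EDC axiom is a statement about R-related pairs of points inside or
-- outside given sets.  Writing a C_R b as "R links a to b", the dual contact
-- a Ĉ_R b says that R links the complement of a to the complement of b, and
-- a ≪_R b says that R does not link a to the complement of b.  The axioms
-- then follow from a few facts about linking: it is monotone, symmetric,
-- splits over unions, and holds between intersecting sets (R reflexive);
-- with excluded middle, a linked pair can moreover be split according to
-- whether its points lie in any given set.
module Submission where

open import Defs
open import Level using (0ℓ)
open import Function using (id; _∘_; flip)
open import Data.Empty using (⊥-elim)
open import Data.Product using (∃-syntax; _×_; _,_; proj₁; proj₂; swap; <_,_>; uncurry)
import Data.Product as Product
open import Data.Sum using (_⊎_; inj₁; inj₂; [_,_]; [_,_]′)
open import Data.Unit using (tt)
open import Relation.Nullary using (¬_; yes; no)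
open import Relation.Binary.Core using (Rel)
open import Relation.Binary.Definitions using (Reflexive; Symmetric)
open import Relation.Binary.Lattice.Structures using (IsBoundedLattice)
import Relation.Binary.Construct.On as On
open import Algebra.Definitions using (_DistributesOverˡ_)
open import Relation.Unary
  using (Pred; _∈_; _∉_; _⊆_; _≐_; ∅; U; _∪_; _∩_; ∁; Satisfiable)
open import Relation.Unary.Properties using (∅-⊆; ⊆-U)
open import Relation.Unary.Relation.Binary.Subset using (⊆-isPartialOrder)
open import Relation.Unary.Algebra using (∩-distribˡ-∪)
open import Axiom.ExcludedMiddle using (ExcludedMiddle)
open import Axiom.DoubleNegationElimination using (em⇒dne)

module SetFacts {W : Set} where

  satisfiable⇒≉∅ : {A : Pred W 0ℓ} → Satisfiable A → ¬ A ≐ ∅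
  satisfiable⇒≉∅ (x , x∈A) (A⊆∅ , _) = A⊆∅ x∈A

  satisfiable-∁⇒≉U : {A : Pred W 0ℓ} → Satisfiable (∁ A) → ¬ A ≐ U
  satisfiable-∁⇒≉U (x , x∉A) (_ , U⊆A) = x∉A (U⊆A tt)

  module Classical (em : ExcludedMiddle 0ℓ) where

    ≉∅⇒satisfiable : {A : Pred W 0ℓ} → ¬ A ≐ ∅ → Satisfiable A
    ≉∅⇒satisfiable A≉∅ =
      em⇒dne em λ ¬∃ → A≉∅ ((λ x∈A → ¬∃ (_ , x∈A)) , λ ())

    ≉U⇒satisfiable-∁ : {A : Pred W 0ℓ} → ¬ A ≐ U → Satisfiable (∁ A)
    ≉U⇒satisfiable-∁ A≉U =
      em⇒dne em λ ¬∃ → A≉U ((λ _ → tt) , λ _ → em⇒dne em λ x∉A → ¬∃ (_ , x∉A))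

    ∁∩⊆∁∪∁ : {A B : Pred W 0ℓ} → ∁ (A ∩ B) ⊆ ∁ A ∪ ∁ B
    ∁∩⊆∁∪∁ {A} {x = x} x∉A∩B with em {x ∈ A}
    ... | yes x∈A = inj₂ λ x∈B → x∉A∩B (x∈A , x∈B)
    ... | no  x∉A = inj₁ x∉A

    ⊆-∩∪∩∁ : {A : Pred W 0ℓ} (S : Pred W 0ℓ) → A ⊆ (A ∩ S) ∪ (A ∩ ∁ S)
    ⊆-∩∪∩∁ S {x} x∈A with em {x ∈ S}
    ... | yes x∈S = inj₁ (x∈A , x∈S)
    ... | no  x∉S = inj₂ (x∈A , x∉S)

module RelationalContact {W : Set} (R : Rel W 0ℓ) where

  Contact : Rel (Pred W 0ℓ) 0ℓ
  Contact A B = ∃[ x ] ∃[ y ] (x ∈ A × y ∈ B × R x y)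

  contact-mono : {A A′ B B′ : Pred W 0ℓ} →
                 Contact A B → A ⊆ A′ → B ⊆ B′ → Contact A′ B′
  contact-mono (x , y , x∈A , y∈B , xRy) A⊆A′ B⊆B′ =
    x , y , A⊆A′ x∈A , B⊆B′ y∈B , xRy

  contact⇒satisfiableˡ : {A B : Pred W 0ℓ} → Contact A B → Satisfiable A
  contact⇒satisfiableˡ (x , _ , x∈A , _) = x , x∈A

  contact⇒satisfiableʳ : {A B : Pred W 0ℓ} → Contact A B → Satisfiable B
  contact⇒satisfiableʳ (_ , y , _ , y∈B , _) = y , y∈B

  contact-∪ˡ : {A B C : Pred W 0ℓ} → Contact (A ∪ B) C → Contact A C ⊎ Contact B C
  contact-∪ˡ (x , y , inj₁ x∈A , y∈C , xRy) = inj₁ (x , y , x∈A , y∈C , xRy)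
  contact-∪ˡ (x , y , inj₂ x∈B , y∈C , xRy) = inj₂ (x , y , x∈B , y∈C , xRy)

  contact-∪ʳ : {A B C : Pred W 0ℓ} → Contact A (B ∪ C) → Contact A B ⊎ Contact A C
  contact-∪ʳ (x , y , x∈A , inj₁ y∈B , xRy) = inj₁ (x , y , x∈A , y∈B , xRy)
  contact-∪ʳ (x , y , x∈A , inj₂ y∈C , xRy) = inj₂ (x , y , x∈A , y∈C , xRy)

  contact-sym : Symmetric R → Symmetric Contact
  contact-sym sym (x , y , x∈A , y∈B , xRy) = y , x , y∈B , x∈A , sym xRy

  satisfiable-∩⇒contact : Reflexive R →
                          {A B : Pred W 0ℓ} → Satisfiable (A ∩ B) → Contact A B
  satisfiable-∩⇒contact refl (x , x∈A , x∈B) = x , x , x∈A , x∈B , refl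

  module Classical (em : ExcludedMiddle 0ℓ) where

    open SetFacts.Classical {W} em

    contact-splitˡ : {A B : Pred W 0ℓ} (S : Pred W 0ℓ) →
                     Contact A B → Contact (A ∩ S) B ⊎ Contact (A ∩ ∁ S) B
    contact-splitˡ {A} S k = contact-∪ˡ (contact-mono k (⊆-∩∪∩∁ {A} S) id)

    contact-splitʳ : {A B : Pred W 0ℓ} (S : Pred W 0ℓ) →
                     Contact A B → Contact A (B ∩ S) ⊎ Contact A (B ∩ ∁ S)
    contact-splitʳ {B = B} S k = contact-∪ʳ (contact-mono k id (⊆-∩∪∩∁ {B} S))

    contact-∁∩ʳ : {A B C : Pred W 0ℓ} →
                  Contact A (∁ (B ∩ C)) → Contact A (∁ B) ⊎ Contact A (∁ C)
    contact-∁∩ʳ {B = B} {C} k = contact-∪ʳ (contact-mono k id (∁∩⊆∁∪∁ {B} {C}))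

    noncontact-∁⇒⊆ : Reflexive R → {A B : Pred W 0ℓ} → ¬ Contact A (∁ B) → A ⊆ B
    noncontact-∁⇒⊆ refl A≪B x∈A =
      em⇒dne em λ x∉B → A≪B (satisfiable-∩⇒contact refl (_ , x∈A , x∉B))

module RelModelProperties {W : Set} (R : Rel W 0ℓ) (𝒟 : Pred (Pred W 0ℓ) 0ℓ)
  (∅∈𝒟 : ∅ ∈ 𝒟) (U∈𝒟 : U ∈ 𝒟)
  (∪-closed : ∀ {a b} → a ∈ 𝒟 → b ∈ 𝒟 → (a ∪ b) ∈ 𝒟)
  (∩-closed : ∀ {a b} → a ∈ 𝒟 → b ∈ 𝒟 → (a ∩ b) ∈ 𝒟) where

  open RelModel R 𝒟
  open Ops ∅∈𝒟 U∈𝒟 ∪-closed ∩-closed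

  ⊆ᴰ-isBoundedLattice : IsBoundedLattice _≈ᴰ_ _⊆ᴰ_ _∪ᴰ_ _∩ᴰ_ 𝟙ᴰ 𝟘ᴰ
  ⊆ᴰ-isBoundedLattice = record
    { isLattice = record
      { isPartialOrder = On.isPartialOrder proj₁ ⊆-isPartialOrder
      ; supremum       = λ _ _ → inj₁ , inj₂ , λ _ a⊆c b⊆c → [ a⊆c , b⊆c ]
      ; infimum        = λ _ _ → proj₁ , proj₂ , λ _ c⊆a c⊆b → < c⊆a , c⊆b >
      }
    ; maximum = ⊆-U ∘ proj₁
    ; minimum = ∅-⊆ ∘ proj₁
    }

  ∩ᴰ-distribˡ-∪ᴰ : _DistributesOverˡ_ _≈ᴰ_ _∩ᴰ_ _∪ᴰ_
  ∩ᴰ-distribˡ-∪ᴰ a b c = ∩-distribˡ-∪ (proj₁ a) (proj₁ b) (proj₁ c)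

  module _ (em : ExcludedMiddle 0ℓ) (refl : Reflexive R) (sym : Symmetric R) where

    open SetFacts {W} hiding (module Classical)
    open SetFacts.Classical {W} em
    open RelationalContact R hiding (module Classical)
    open RelationalContact.Classical R em
    open IsEDCLattice

    isEDCLattice : IsEDCLattice _≈ᴰ_ _⊆ᴰ_ 𝟘ᴰ 𝟙ᴰ _∪ᴰ_ _∩ᴰ_ C-R Ĉ-R ≪-R
    isEDCLattice .isBoundedLattice = ⊆ᴰ-isBoundedLattice
    isEDCLattice .·-distribˡ-+ = ∩ᴰ-distribˡ-∪ᴰ
    isEDCLattice .C1 k =
      satisfiable⇒≉∅ (contact⇒satisfiableˡ k) , satisfiable⇒≉∅ (contact⇒satisfiableʳ k)
    isEDCLattice .C2 = contact-mono
    isEDCLattice .C3 = contact-∪ʳ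
    isEDCLattice .C4 = contact-sym sym
    isEDCLattice .C5 a∩b≉∅ = satisfiable-∩⇒contact refl (≉∅⇒satisfiable a∩b≉∅)
    isEDCLattice .Ĉ1 k =
      satisfiable-∁⇒≉U (contact⇒satisfiableˡ k) , satisfiable-∁⇒≉U (contact⇒satisfiableʳ k)
    isEDCLattice .Ĉ2 k a′⊆a b′⊆b = contact-mono k (_∘ a′⊆a) (_∘ b′⊆b)
    isEDCLattice .Ĉ3 = contact-∁∩ʳ
    isEDCLattice .Ĉ4 = contact-sym sym
    isEDCLattice .Ĉ5 a∪b≉U =
      satisfiable-∩⇒contact refl (Product.map₂ < _∘ inj₁ , _∘ inj₂ > (≉U⇒satisfiable-∁ a∪b≉U))
    isEDCLattice .≪1 k = proj₂ (contact⇒satisfiableˡ k)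
    isEDCLattice .≪2 k = proj₂ (contact⇒satisfiableʳ k) tt
    isEDCLattice .≪3 = noncontact-∁⇒⊆ refl
    isEDCLattice .≪4 a′⊆a a≪b b⊆b′ k = a≪b (contact-mono k a′⊆a (_∘ b⊆b′))
    isEDCLattice .≪5 a≪c b≪c k = [ a≪c , b≪c ] (contact-∪ˡ k)
    isEDCLattice .≪6 c≪a c≪b k = [ c≪a , c≪b ] (contact-∁∩ʳ k)
    isEDCLattice .≪7 {a} {b} a≪b bc≪d c≪ad k with contact-splitʳ (proj₁ a) k
    ... | inj₂ k′ = c≪ad (contact-mono k′ id (uncurry (flip [_,_]′)))
    ... | inj₁ k′ with contact-splitˡ (proj₁ b) k′
    ...   | inj₁ k″ = bc≪d (contact-mono k″ swap proj₁)
    ...   | inj₂ k″ = a≪b (contact-sym sym (contact-mono k″ proj₂ proj₂))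
    isEDCLattice .MC1 {c = c} k a≪c with contact-splitʳ (proj₁ c) k
    ... | inj₁ k′ = k′
    ... | inj₂ k′ = ⊥-elim (a≪c (contact-mono k′ id proj₂))
    isEDCLattice .MC2 ¬C[a,bc] (x , y , x∈a , y∈b , xRy) ¬C[ad,b] =
      x , y , (λ x∈d → ¬C[ad,b] (x , y , (x∈a , x∈d) , y∈b , xRy))
            , (λ y∈c → ¬C[a,bc] (x , y , x∈a , (y∈b , y∈c) , xRy)) , xRy
    isEDCLattice .MĈ1 (x , y , x∉a , y∉b , xRy) c≪a =
      x , y , x∉a , [ y∉b , (λ y∈c → c≪a (y , x , y∈c , x∉a , sym xRy)) ] , xRy
    isEDCLattice .MĈ2 {c = c} {d} ¬Ĉ[a,b+c] k ¬Ĉ[a+d,b] with contact-splitˡ (proj₁ d) k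
    ... | inj₂ k′ = ⊥-elim (¬Ĉ[a+d,b] (contact-mono k′ (uncurry [_,_]′) id))
    ... | inj₁ k′ with contact-splitʳ (proj₁ c) k′
    ...   | inj₁ k″ = contact-mono k″ proj₂ proj₂
    ...   | inj₂ k″ = ⊥-elim (¬Ĉ[a,b+c] (contact-mono k″ proj₁ (uncurry [_,_]′)))
    isEDCLattice .M≪1 {a} ¬Ĉ[a,b] ac≪b k with contact-splitˡ (proj₁ a) k
    ... | inj₁ k′ = ac≪b (contact-mono k′ swap id)
    ... | inj₂ k′ = ¬Ĉ[a,b] (contact-mono k′ proj₂ id)
    isEDCLattice .M≪2 ¬C[a,b] b≪ac (x , y , x∈b , y∉c , xRy) =
      b≪ac (x , y , x∈b , [ (λ y∈a → ¬C[a,b] (y , x , y∈a , x∈b , sym xRy)) , y∉c ] , xRy)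

mainTheorem8 : ExcludedMiddle 0ℓ →
    (W : Set) → W →
    (R : Rel W 0ℓ) → Reflexive R → Symmetric R →
    (𝒟 : Pred (Pred W 0ℓ) 0ℓ) →
    (∅∈𝒟 : ∅ ∈ 𝒟) → (U∈𝒟 : U ∈ 𝒟) →
    (∪-closed : ∀ {a b} → a ∈ 𝒟 → b ∈ 𝒟 → (a ∪ b) ∈ 𝒟) →
    (∩-closed : ∀ {a b} → a ∈ 𝒟 → b ∈ 𝒟 → (a ∩ b) ∈ 𝒟) →
    let open RelModel R 𝒟
        open Ops ∅∈𝒟 U∈𝒟 ∪-closed ∩-closed
    in IsEDCLattice _≈ᴰ_ _⊆ᴰ_ 𝟘ᴰ 𝟙ᴰ _∪ᴰ_ _∩ᴰ_ C-R Ĉ-R ≪-R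
mainTheorem8 em W _ R refl sym 𝒟 ∅∈𝒟 U∈𝒟 ∪-closed ∩-closed =
  RelModelProperties.isEDCLattice R 𝒟 ∅∈𝒟 U∈𝒟 ∪-closed ∩-closed em refl sym
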